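{- For every $n\geq 3$, the directed general butterfly graph $E_n$ admits a strong SA$(2n,1)$AL, i.e. a strong total labeling whose subtractive arc-weights are exactly $2n,2n+1,\ldots,4n-1$.
   Context: The directed general butterfly graph $E_n$ consists of two directed cycles $v_1v_2\cdots v_nv_1$ and $u_1u_2\cdots u_nu_1$ (arcs $v_iv_{i+1}$, $u_iu_{i+1}$ for $1\le i\le n-1$, and $v_nv_1$, $u_nu_1$) sharing exactly one common vertex $x=v_n=u_n$; so it has $2n-1$ vertices and $2n$ arcs. For a digraph $G=(V,A)$, a total labeling is a bijection $\lambda:V\cup A\to\{1,2,\ldots,|V|+|A|\}$. For an arc $yz$ (tail $y$, head $z$), $wt^-(yz)=\lambda(yz)+\lambda(z)-\lambda(y)$. An SA$(a,d)$AL is a total labeling whose set of arc-weights is $\{a,a+d,\ldots,a+(|A|-1)d\}$ (all distinct). A total labeling is strong if $\lambda(V)=\{1,\ldots,|V|\}$. -}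

module Defs where

open import Data.Nat using (ℕ; zero; suc; _+_; _*_; _∸_; _≤_; _<?_; _≟_)
open import Relation.Nullary using (yes; no)
open import Data.Fin using (Fin; toℕ; fromℕ<)
open import Data.Sum using (_⊎_; inj₁; inj₂)
open import Data.Integer as ℤ using (ℤ; +_)
open import Data.Product using (Σ; _×_; _,_; ∃)
open import Function.Bundles using (_⤖_; module Bijection)
open import Relation.Binary.PropositionalEquality using (_≡_)

-- Vertices of the butterfly E_n:
--   vV i  (i : Fin (n-1), toℕ i = k)  stands for v_{k+1}
--   uV i  (i : Fin (n-1), toℕ i = k)  stands for u_{k+1}
--   xV    stands for the shared vertex x = v_n = u_n
-- so there are (n-1)+(n-1)+1 = 2n-1 vertices (for n ≥ 1).
data Vtx (n : ℕ) : Set where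
  vV : Fin (n ∸ 1) → Vtx n
  uV : Fin (n ∸ 1) → Vtx n
  xV : Vtx n

-- v_j for j : ℕ, with 1 ≤ j ≤ n-1 mapping to vV and j = n (or anything
-- out of range) mapping to x.  Only used with 1 ≤ j ≤ n below.
vAt : (n j : ℕ) → Vtx n
vAt n zero = xV
vAt n (suc k) with _<?_ k (n ∸ 1)
... | yes k<  = vV (fromℕ< k<)
... | no _    = xV

uAt : (n j : ℕ) → Vtx n
uAt n zero = xV
uAt n (suc k) with _<?_ k (n ∸ 1)
... | yes k<  = uV (fromℕ< k<)
... | no _    = xV

-- Arcs of E_n: vA i (toℕ i = k, 0 ≤ k ≤ n-1) is the arc v_{k+1} v_{k+2}
-- (with v_{n+1} := v_1, i.e. the last arc is v_n v_1 = x v_1);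
-- similarly uA i.  So there are 2n arcs.
data Arc (n : ℕ) : Set where
  vA : Fin n → Arc n
  uA : Fin n → Arc n

nextIdx : (n k : ℕ) → ℕ
nextIdx n k with _≟_ (suc k) n
... | yes _ = 1
... | no _  = suc (suc k)

tail : {n : ℕ} → Arc n → Vtx n
tail {n} (vA i) = vAt n (suc (toℕ i))
tail {n} (uA i) = uAt n (suc (toℕ i))

head : {n : ℕ} → Arc n → Vtx n
head {n} (vA i) = vAt n (nextIdx n (toℕ i))
head {n} (uA i) = uAt n (nextIdx n (toℕ i))

-- |V| + |A| = (2n-1) + 2n = 4n-1
numElems : ℕ → ℕ
numElems n = 4 * n ∸ 1

-- A total labeling: a bijection from V ∪ A onto {1,…,|V|+|A|};
-- we encode {1,…,N} as Fin N with label toℕ k + 1.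
TotalLabeling : ℕ → Set
TotalLabeling n = (Vtx n ⊎ Arc n) ⤖ Fin (numElems n)

open Bijection

lab : {n : ℕ} → TotalLabeling n → Vtx n ⊎ Arc n → ℕ
lab L e = suc (toℕ (to L e))

-- strong: vertices receive exactly the labels 1..|V| = 1..2n-1
-- (equivalently, since λ is a bijection, λ(V) = {1,…,|V|}):
-- every vertex label is ≤ 2n-1, and every label ≤ 2n-1 is a vertex label.
IsStrong : {n : ℕ} → TotalLabeling n → Set
IsStrong {n} L =
  ((y : Vtx n) → lab L (inj₁ y) ≤ 2 * n ∸ 1) ×
  ((k : ℕ) → 1 ≤ k → k ≤ 2 * n ∸ 1 → ∃ λ (y : Vtx n) → lab L (inj₁ y) ≡ k)

wt : {n : ℕ} → TotalLabeling n → Arc n → ℤ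
wt L a = (+ lab L (inj₂ a) ℤ.+ + lab L (inj₁ (head a))) ℤ.- + lab L (inj₁ (tail a))

-- SA(a,d)AL: the set of arc weights is exactly {a, a+d, …, a+(|A|-1)d}
-- with all weights distinct, i.e. arc ↦ weight is a bijection from A onto
-- that progression.  |A| = 2n.
IsSAAL : {n : ℕ} → TotalLabeling n → ℤ → ℤ → Set
IsSAAL {n} L a d =
  Σ (Arc n ⤖ Fin (2 * n)) λ B →
    (e : Arc n) → wt L e ≡ a ℤ.+ (+ toℕ (Bijection.to B e)) ℤ.* d

-- Label v_i by i, u_i by n - 1 + i and x by 2n - 1.  Along the paths v_1 ⋯ v_{n-1} and
-- u_1 ⋯ u_{n-1} x every head label exceeds the tail label by one, so an arc of these paths has
-- weight one more than its own label.  Labelling v_1v_2, …, v_{n-2}v_{n-1} by 2n+1, …, 3n-2 and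
-- u_1u_2, …, u_{n-1}x by 3n, …, 4n-2 gives the weights 2n+2, …, 3n-1 and 3n+1, …, 4n-1; the
-- remaining labels 2n, 3n-1, 4n-1 go to v_{n-1}x, xu_1, xv_1, whose weights are 3n, 2n, 2n+1.

module Submission where

open import Defs
open import Data.Empty using (⊥-elim)
open import Data.Fin using (Fin; toℕ; fromℕ; fromℕ<; inject₁)
open import Data.Fin.Properties
  using (toℕ<n; toℕ-fromℕ; toℕ-fromℕ<; toℕ-inject₁; toℕ-↑ˡ; toℕ-↑ʳ; +↔⊎; 1↔⊤)
open import Data.Fin.Relation.Unary.Top
  using (View; ‵fromℕ; ‵inj₁; ‵inject₁; view; view-fromℕ; view-inject₁)
open import Data.Integer as ℤ using (+_)
import Data.Integer.Properties as ℤ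
open import Data.Nat using (ℕ; zero; suc; _+_; _*_; _∸_; _≤_; _<_; s≤s; z≤n; _<?_; _≟_)
open import Data.Nat.Properties
  using (+-assoc; +-suc; +-identityʳ; +-commutativeSemigroup; m≤m+n; m+n∸m≡n;
         ≤-refl; ≤-reflexive; ≤-trans; ≤-antisym; <⇒≤; <⇒≢; <-irrefl; ≮⇒≥; m<n⇒m<1+n)
open import Algebra.Properties.CommutativeSemigroup +-commutativeSemigroup using (x∙yz≈y∙xz)
open import Data.Nat.Tactic.RingSolver using (solve-∀)
open import Data.Product using (Σ; _×_; _,_; ∃)
open import Data.Sum using (_⊎_; inj₁; inj₂)
open import Data.Sum.Function.Propositional using (_⊎-↔_)
open import Data.Unit using (⊤; tt)
open import Function.Bundles using (_↔_; mk↔ₛ′; Inverse)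
open import Function.Properties.Inverse using (↔⇒⤖; ↔-sym; ↔-trans; ↔-refl)
open import Relation.Binary.PropositionalEquality
  using (_≡_; refl; sym; trans; cong; cong₂; module ≡-Reasoning)
open import Relation.Nullary using (yes; no)

private variable
  A B : Set
  a b k N M : ℕ

rank : A ↔ Fin N → A → ℕ
rank e x = toℕ (Inverse.to e x)

rank-surjective : (e : A ↔ Fin N) → k < N → ∃ λ x → rank e x ≡ k
rank-surjective e k<N =
  Inverse.from e (fromℕ< k<N) , trans (cong toℕ (Inverse.strictlyInverseˡ e _)) (toℕ-fromℕ< k<N)

infixr 4 _⊕_
_⊕_ : A ↔ Fin a → B ↔ Fin b → (A ⊎ B) ↔ Fin (a + b)
e ⊕ f = ↔-trans (e ⊎-↔ f) (↔-sym +↔⊎)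

rank-⊕-inj₁ : (e : A ↔ Fin a) (f : B ↔ Fin b) (x : A) → rank (e ⊕ f) (inj₁ x) ≡ rank e x
rank-⊕-inj₁ {b = b} e f x = toℕ-↑ˡ (Inverse.to e x) b

rank-⊕-inj₂ : (e : A ↔ Fin a) (f : B ↔ Fin b) (y : B) → rank (e ⊕ f) (inj₂ y) ≡ a + rank f y
rank-⊕-inj₂ {a = a} e f y = toℕ-↑ʳ a (Inverse.to f y)

point : ⊤ ↔ Fin 1
point = ↔-sym 1↔⊤

segment : ∀ k → Fin k ↔ Fin k
segment k = ↔-refl

recast : N ≡ M → A ↔ Fin N → A ↔ Fin M
recast refl e = e

rank-recast : (eq : N ≡ M) (e : A ↔ Fin N) (x : A) → rank (recast eq e) x ≡ rank e x
rank-recast refl e x = refl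

wt-from-labels : ∀ {n} (L : TotalLabeling n) (e : Arc n) {w : ℕ} →
  lab L (inj₂ e) + lab L (inj₁ (head e)) ≡ lab L (inj₁ (tail e)) + w → wt L e ≡ + w
wt-from-labels L e {w} balance = begin
  wt L e                ≡⟨ cong (λ s → + s ℤ.- + t) balance ⟩
  + (t + w) ℤ.- + t     ≡⟨ ℤ.[+m]-[+n]≡m⊖n (t + w) t ⟩
  (t + w) ℤ.⊖ t         ≡⟨ ℤ.⊖-≥ (m≤m+n t w) ⟩
  + (t + w ∸ t)         ≡⟨ cong +_ (m+n∸m≡n t w) ⟩
  + w                   ∎
  where
  open ≡-Reasoning
  t = lab L (inj₁ (tail e))

wt-from-offsets : ∀ {n} (L : TotalLabeling n) (e : Arc n) {c r w : ℕ} → lab L (inj₂ e) ≡ c + r →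
  r + lab L (inj₁ (head e)) ≡ lab L (inj₁ (tail e)) + w → wt L e ≡ + (c + w)
wt-from-offsets L e {c} {r} {w} lab-e balance = wt-from-labels L e (begin
  lab L (inj₂ e) + h  ≡⟨ cong (_+ h) lab-e ⟩
  c + r + h           ≡⟨ +-assoc c r h ⟩
  c + (r + h)         ≡⟨ cong (_+_ c) balance ⟩
  c + (t + w)         ≡⟨ x∙yz≈y∙xz c t w ⟩
  t + (c + w)         ∎)
  where
  open ≡-Reasoning
  h = lab L (inj₁ (head e))
  t = lab L (inj₁ (tail e))

progression-term : ∀ a r → + (a + r) ≡ + a ℤ.+ + r ℤ.* + 1
progression-term a r = cong (ℤ._+_ (+ a)) (sym (ℤ.*-identityʳ (+ r)))

nextIdx-inner : ∀ {n k} → suc k < n → nextIdx n k ≡ suc (suc k)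
nextIdx-inner {n} {k} lt with suc k ≟ n
... | yes eq = ⊥-elim (<⇒≢ lt eq)
... | no _   = refl

nextIdx-last : ∀ k → nextIdx (suc k) k ≡ 1
nextIdx-last k with suc k ≟ suc k
... | yes _ = refl
... | no ne = ⊥-elim (ne refl)

module ButterflyLabeling (q : ℕ) where

  n p : ℕ
  n = 2 + q
  p = 1 + q

  vertexLabel : Vtx n → ℕ
  vertexLabel (vV i) = suc (toℕ i)
  vertexLabel (uV i) = suc (p + toℕ i)
  vertexLabel xV     = suc (p + p)

  vertexLabel-vAt : ∀ t → t < p → vertexLabel (vAt n (suc t)) ≡ suc t
  vertexLabel-vAt t t<p with t <? p
  ... | yes t<p′ = cong suc (toℕ-fromℕ< t<p′)
  ... | no t≮p   = ⊥-elim (t≮p t<p)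

  vertexLabel-vAt-x : vertexLabel (vAt n (suc p)) ≡ suc (p + p)
  vertexLabel-vAt-x with p <? p
  ... | yes p<p = ⊥-elim (<-irrefl refl p<p)
  ... | no _    = refl

  vertexLabel-uAt : ∀ s → s ≤ p → vertexLabel (uAt n (suc s)) ≡ suc (p + s)
  vertexLabel-uAt s s≤p with s <? p
  ... | yes s<p = cong (λ r → suc (p + r)) (toℕ-fromℕ< s<p)
  ... | no s≮p  = cong (λ r → suc (p + r)) (≤-antisym (≮⇒≥ s≮p) s≤p)

  -- v-path j is v_{j+1}v_{j+2} (j < n-2), u-path j is u_{j+1}u_{j+2} (j < n-1, with u_n = x).
  data ArcClass : Arc n → Set where
    v-path   : (j : Fin q) → ArcClass (vA (inject₁ (inject₁ j)))
    v-into-x : ArcClass (vA (inject₁ (fromℕ q)))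
    x-v₁     : ArcClass (vA (fromℕ p))
    u-path   : (j : Fin p) → ArcClass (uA (inject₁ j))
    x-u₁     : ArcClass (uA (fromℕ p))

  classify-vA : {i : Fin n} → View i → ArcClass (vA i)
  classify-vA ‵fromℕ               = x-v₁
  classify-vA (‵inj₁ ‵fromℕ)       = v-into-x
  classify-vA (‵inj₁ (‵inject₁ j)) = v-path j

  classify-uA : {i : Fin n} → View i → ArcClass (uA i)
  classify-uA ‵fromℕ       = x-u₁
  classify-uA (‵inject₁ j) = u-path j

  classify : (e : Arc n) → ArcClass e
  classify (vA i) = classify-vA (view i)
  classify (uA i) = classify-uA (view i)

  classify-unique : ∀ {e} (c : ArcClass e) → classify e ≡ c
  classify-unique (v-path j) rewrite view-inject₁ (inject₁ j) | view-inject₁ j = refl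
  classify-unique v-into-x   rewrite view-inject₁ (fromℕ q) | view-fromℕ q = refl
  classify-unique x-v₁       rewrite view-fromℕ p = refl
  classify-unique (u-path j) rewrite view-inject₁ j = refl
  classify-unique x-u₁       rewrite view-fromℕ p = refl

  -- An arc of class c will receive label 2n + labelOffset c and weight 2n + weightOffset c.
  labelOffset weightOffset tailLabel headLabel : ∀ {e} → ArcClass e → ℕ
  labelOffset v-into-x   = 0
  labelOffset (v-path j) = suc (toℕ j)
  labelOffset x-u₁       = p
  labelOffset (u-path j) = n + toℕ j
  labelOffset x-v₁       = n + p
  weightOffset x-u₁       = 0
  weightOffset x-v₁       = 1
  weightOffset (v-path j) = 2 + toℕ j
  weightOffset v-into-x   = n
  weightOffset (u-path j) = suc n + toℕ j
  tailLabel (v-path j) = suc (toℕ j)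
  tailLabel v-into-x   = p
  tailLabel x-v₁       = suc (p + p)
  tailLabel (u-path j) = suc (p + toℕ j)
  tailLabel x-u₁       = suc (p + p)
  headLabel (v-path j) = 2 + toℕ j
  headLabel v-into-x   = suc (p + p)
  headLabel x-v₁       = 1
  headLabel (u-path j) = suc (p + suc (toℕ j))
  headLabel x-u₁       = suc (p + 0)

  offsets-balance : ∀ {e} (c : ArcClass e) → labelOffset c + headLabel c ≡ tailLabel c + weightOffset c
  offsets-balance (v-path j) = refl
  offsets-balance v-into-x   = sym (+-suc p p)
  offsets-balance x-v₁       = refl
  offsets-balance (u-path j) = at-u-path q (toℕ j)
    where
    at-u-path : ∀ k t → 2 + k + t + suc (suc k + suc t) ≡ suc (suc k + t) + (3 + k + t)
    at-u-path = solve-∀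
  offsets-balance x-u₁       = at-x-u₁ q
    where
    at-x-u₁ : ∀ k → suc k + suc (suc k + 0) ≡ suc (suc k + suc k) + 0
    at-x-u₁ = solve-∀

  vLabel uLabel : ℕ → ℕ
  vLabel k = vertexLabel (vAt n k)
  uLabel k = vertexLabel (uAt n k)

  toℕ-v-path : (j : Fin q) → toℕ (inject₁ (inject₁ j)) ≡ toℕ j
  toℕ-v-path j = trans (toℕ-inject₁ (inject₁ j)) (toℕ-inject₁ j)

  toℕ-v-into-x : toℕ (inject₁ (fromℕ q)) ≡ q
  toℕ-v-into-x = trans (toℕ-inject₁ (fromℕ q)) (toℕ-fromℕ q)

  tail-label : ∀ {e} (c : ArcClass e) → vertexLabel (tail e) ≡ tailLabel c
  tail-label (v-path j) = trans (cong (λ t → vLabel (suc t)) (toℕ-v-path j))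
                                (vertexLabel-vAt (toℕ j) (m<n⇒m<1+n (toℕ<n j)))
  tail-label v-into-x   = trans (cong (λ t → vLabel (suc t)) toℕ-v-into-x) (vertexLabel-vAt q ≤-refl)
  tail-label x-v₁       = trans (cong (λ t → vLabel (suc t)) (toℕ-fromℕ p)) vertexLabel-vAt-x
  tail-label (u-path j) = trans (cong (λ t → uLabel (suc t)) (toℕ-inject₁ j))
                                (vertexLabel-uAt (toℕ j) (<⇒≤ (toℕ<n j)))
  tail-label x-u₁       = trans (cong (λ t → uLabel (suc t)) (toℕ-fromℕ p)) (vertexLabel-uAt p ≤-refl)

  head-label : ∀ {e} (c : ArcClass e) → vertexLabel (head e) ≡ headLabel c
  head-label (v-path j) = trans (cong (λ t → vLabel (nextIdx n t)) (toℕ-v-path j))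
    (trans (cong vLabel (nextIdx-inner (s≤s (m<n⇒m<1+n (toℕ<n j)))))
           (vertexLabel-vAt (suc (toℕ j)) (s≤s (toℕ<n j))))
  head-label v-into-x   = trans (cong (λ t → vLabel (nextIdx n t)) toℕ-v-into-x)
    (trans (cong vLabel (nextIdx-inner {n} {q} ≤-refl)) vertexLabel-vAt-x)
  head-label x-v₁       = trans (cong (λ t → vLabel (nextIdx n t)) (toℕ-fromℕ p))
    (trans (cong vLabel (nextIdx-last p)) (vertexLabel-vAt 0 (s≤s z≤n)))
  head-label (u-path j) = trans (cong (λ t → uLabel (nextIdx n t)) (toℕ-inject₁ j))
    (trans (cong uLabel (nextIdx-inner (s≤s (toℕ<n j)))) (vertexLabel-uAt (suc (toℕ j)) (toℕ<n j)))
  head-label x-u₁       = trans (cong (λ t → uLabel (nextIdx n t)) (toℕ-fromℕ p))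
    (trans (cong uLabel (nextIdx-last p)) (vertexLabel-uAt 0 z≤n))

  vertexEnum : Vtx n ↔ Fin (p + (p + 1))
  vertexEnum = ↔-trans (mk↔ₛ′ split join
                          (λ { (inj₁ i) → refl ; (inj₂ (inj₁ i)) → refl ; (inj₂ (inj₂ tt)) → refl })
                          (λ { (vV i) → refl ; (uV i) → refl ; xV → refl }))
                       (segment p ⊕ segment p ⊕ point)
    where
    split : Vtx n → Fin p ⊎ (Fin p ⊎ ⊤)
    split (vV i) = inj₁ i
    split (uV i) = inj₂ (inj₁ i)
    split xV     = inj₂ (inj₂ tt)
    join : Fin p ⊎ (Fin p ⊎ ⊤) → Vtx n
    join (inj₁ i)         = vV i
    join (inj₂ (inj₁ i))  = uV i
    join (inj₂ (inj₂ tt)) = xV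

  rank-vertexEnum : ∀ y → suc (rank vertexEnum y) ≡ vertexLabel y
  rank-vertexEnum (vV i) = cong suc (rank-⊕-inj₁ (segment p) (segment p ⊕ point) i)
  rank-vertexEnum (uV i) = cong suc (trans (rank-⊕-inj₂ (segment p) (segment p ⊕ point) (inj₁ i))
                                           (cong (_+_ p) (rank-⊕-inj₁ (segment p) point i)))
  rank-vertexEnum xV     = cong suc (trans (rank-⊕-inj₂ (segment p) (segment p ⊕ point) (inj₂ tt))
                                           (cong (_+_ p) (trans (rank-⊕-inj₂ (segment p) point tt)
                                                                (+-identityʳ p))))

  enumerateByClass : (slot : ∀ {e} → ArcClass e → B) (arcAt : B → Arc n) →
    (∀ {e} (c : ArcClass e) → arcAt (slot c) ≡ e) →
    (∀ b → Σ (ArcClass (arcAt b)) λ c → slot c ≡ b) →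
    Arc n ↔ B
  enumerateByClass slot arcAt arcAt-slot slot-onto = mk↔ₛ′ (λ e → slot (classify e)) arcAt
    (λ b → let c , slot-c≡b = slot-onto b in trans (cong slot (classify-unique c)) slot-c≡b)
    (λ e → arcAt-slot (classify e))

  LabelSlots : Set
  LabelSlots = ⊤ ⊎ (Fin q ⊎ (⊤ ⊎ (Fin p ⊎ ⊤)))

  labelSlot : ∀ {e} → ArcClass e → LabelSlots
  labelSlot v-into-x   = inj₁ tt
  labelSlot (v-path j) = inj₂ (inj₁ j)
  labelSlot x-u₁       = inj₂ (inj₂ (inj₁ tt))
  labelSlot (u-path j) = inj₂ (inj₂ (inj₂ (inj₁ j)))
  labelSlot x-v₁       = inj₂ (inj₂ (inj₂ (inj₂ tt)))

  labelSlots : LabelSlots ↔ Fin (1 + (q + (1 + (p + 1))))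
  labelSlots = point ⊕ segment q ⊕ point ⊕ segment p ⊕ point

  arcsByLabel : Arc n ↔ Fin (1 + (q + (1 + (p + 1))))
  arcsByLabel = ↔-trans
    (enumerateByClass labelSlot arcAt
      (λ { v-into-x → refl ; (v-path j) → refl ; x-u₁ → refl ; (u-path j) → refl ; x-v₁ → refl })
      (λ { (inj₁ tt)                     → v-into-x , refl
         ; (inj₂ (inj₁ j))               → v-path j , refl
         ; (inj₂ (inj₂ (inj₁ tt)))       → x-u₁ , refl
         ; (inj₂ (inj₂ (inj₂ (inj₁ j)))) → u-path j , refl
         ; (inj₂ (inj₂ (inj₂ (inj₂ tt)))) → x-v₁ , refl }))
    labelSlots
    where
    arcAt : LabelSlots → Arc n
    arcAt (inj₁ tt)                      = vA (inject₁ (fromℕ q))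
    arcAt (inj₂ (inj₁ j))                = vA (inject₁ (inject₁ j))
    arcAt (inj₂ (inj₂ (inj₁ tt)))        = uA (fromℕ p)
    arcAt (inj₂ (inj₂ (inj₂ (inj₁ j))))  = uA (inject₁ j)
    arcAt (inj₂ (inj₂ (inj₂ (inj₂ tt)))) = vA (fromℕ p)

  rank-arcsByLabel : ∀ {e} (c : ArcClass e) → rank arcsByLabel e ≡ labelOffset c
  rank-arcsByLabel c =
    trans (cong (λ c′ → rank labelSlots (labelSlot c′)) (classify-unique c)) (position c)
    where
    rest : (⊤ ⊎ (Fin p ⊎ ⊤)) ↔ Fin (1 + (p + 1))
    rest = point ⊕ segment p ⊕ point
    position : ∀ {e} (c : ArcClass e) → rank labelSlots (labelSlot c) ≡ labelOffset c
    position v-into-x   = refl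
    position (v-path j) = cong suc (rank-⊕-inj₁ (segment q) rest j)
    position x-u₁       = cong suc (trans (rank-⊕-inj₂ (segment q) rest (inj₁ tt)) (+-identityʳ q))
    position (u-path j) = cong suc (trans (rank-⊕-inj₂ (segment q) rest (inj₂ (inj₁ j)))
                                   (trans (cong (λ r → q + suc r) (rank-⊕-inj₁ (segment p) point j))
                                          (+-suc q (toℕ j))))
    position x-v₁       = cong suc (trans (rank-⊕-inj₂ (segment q) rest (inj₂ (inj₂ tt)))
                                   (trans (cong (λ r → q + suc r) (trans (rank-⊕-inj₂ (segment p) point tt)
                                                                         (+-identityʳ p)))
                                          (+-suc q p)))

  WeightSlots : Set
  WeightSlots = ⊤ ⊎ (⊤ ⊎ (Fin q ⊎ (⊤ ⊎ Fin p)))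

  weightSlot : ∀ {e} → ArcClass e → WeightSlots
  weightSlot x-u₁       = inj₁ tt
  weightSlot x-v₁       = inj₂ (inj₁ tt)
  weightSlot (v-path j) = inj₂ (inj₂ (inj₁ j))
  weightSlot v-into-x   = inj₂ (inj₂ (inj₂ (inj₁ tt)))
  weightSlot (u-path j) = inj₂ (inj₂ (inj₂ (inj₂ j)))

  weightSlots : WeightSlots ↔ Fin (1 + (1 + (q + (1 + p))))
  weightSlots = point ⊕ point ⊕ segment q ⊕ point ⊕ segment p

  arcsByWeight : Arc n ↔ Fin (1 + (1 + (q + (1 + p))))
  arcsByWeight = ↔-trans
    (enumerateByClass weightSlot arcAt
      (λ { x-u₁ → refl ; x-v₁ → refl ; (v-path j) → refl ; v-into-x → refl ; (u-path j) → refl })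
      (λ { (inj₁ tt)                      → x-u₁ , refl
         ; (inj₂ (inj₁ tt))               → x-v₁ , refl
         ; (inj₂ (inj₂ (inj₁ j)))         → v-path j , refl
         ; (inj₂ (inj₂ (inj₂ (inj₁ tt)))) → v-into-x , refl
         ; (inj₂ (inj₂ (inj₂ (inj₂ j))))  → u-path j , refl }))
    weightSlots
    where
    arcAt : WeightSlots → Arc n
    arcAt (inj₁ tt)                      = uA (fromℕ p)
    arcAt (inj₂ (inj₁ tt))               = vA (fromℕ p)
    arcAt (inj₂ (inj₂ (inj₁ j)))         = vA (inject₁ (inject₁ j))
    arcAt (inj₂ (inj₂ (inj₂ (inj₁ tt)))) = vA (inject₁ (fromℕ q))
    arcAt (inj₂ (inj₂ (inj₂ (inj₂ j))))  = uA (inject₁ j)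

  rank-arcsByWeight : ∀ {e} (c : ArcClass e) → rank arcsByWeight e ≡ weightOffset c
  rank-arcsByWeight c =
    trans (cong (λ c′ → rank weightSlots (weightSlot c′)) (classify-unique c)) (position c)
    where
    rest : (⊤ ⊎ Fin p) ↔ Fin (1 + p)
    rest = point ⊕ segment p
    position : ∀ {e} (c : ArcClass e) → rank weightSlots (weightSlot c) ≡ weightOffset c
    position x-u₁       = refl
    position x-v₁       = refl
    position (v-path j) = cong (_+_ 2) (rank-⊕-inj₁ (segment q) rest j)
    position v-into-x   = cong (_+_ 2) (trans (rank-⊕-inj₂ (segment q) rest (inj₁ tt)) (+-identityʳ q))
    position (u-path j) = cong (_+_ 2) (trans (rank-⊕-inj₂ (segment q) rest (inj₂ j)) (+-suc q (toℕ j)))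

  vertexCount : p + (p + 1) ≡ 2 * n ∸ 1
  vertexCount = count q
    where
    count : ∀ k → suc k + (suc k + 1) ≡ suc k + (2 + k + 0)
    count = solve-∀

  elementCount : p + (p + 1) + (1 + (q + (1 + (p + 1)))) ≡ 4 * n ∸ 1
  elementCount = count q
    where
    count : ∀ k → suc k + (suc k + 1) + (1 + (k + (1 + (suc k + 1))))
                  ≡ suc k + (2 + k + (2 + k + (2 + k + 0)))
    count = solve-∀

  arcCount : 1 + (1 + (q + (1 + p))) ≡ 2 * n
  arcCount = count q
    where
    count : ∀ k → 1 + (1 + (k + (1 + suc k))) ≡ 2 + k + (2 + k + 0)
    count = solve-∀

  elements : (Vtx n ⊎ Arc n) ↔ Fin (p + (p + 1) + (1 + (q + (1 + (p + 1)))))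
  elements = vertexEnum ⊕ arcsByLabel

  labeling : TotalLabeling n
  labeling = ↔⇒⤖ (recast elementCount elements)

  lab-vertex-rank : ∀ y → lab labeling (inj₁ y) ≡ suc (rank vertexEnum y)
  lab-vertex-rank y =
    cong suc (trans (rank-recast elementCount elements (inj₁ y)) (rank-⊕-inj₁ vertexEnum arcsByLabel y))

  lab-vertex : ∀ y → lab labeling (inj₁ y) ≡ vertexLabel y
  lab-vertex y = trans (lab-vertex-rank y) (rank-vertexEnum y)

  lab-arc : ∀ {e} (c : ArcClass e) → lab labeling (inj₂ e) ≡ 2 * n + labelOffset c
  lab-arc {e} c = begin
    lab labeling (inj₂ e)                  ≡⟨ cong suc (rank-recast elementCount elements (inj₂ e)) ⟩
    suc (rank elements (inj₂ e))           ≡⟨ cong suc (rank-⊕-inj₂ vertexEnum arcsByLabel e) ⟩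
    suc (p + (p + 1)) + rank arcsByLabel e ≡⟨ cong₂ _+_ arcBase (rank-arcsByLabel c) ⟩
    2 * n + labelOffset c                  ∎
    where
    open ≡-Reasoning
    arcBase : suc (p + (p + 1)) ≡ 2 * n
    arcBase = base q
      where
      base : ∀ k → suc (suc k + (suc k + 1)) ≡ 2 * (2 + k)
      base = solve-∀

  labeling-strong : IsStrong labeling
  labeling-strong = bounded , onto
    where
    bounded : ∀ y → lab labeling (inj₁ y) ≤ 2 * n ∸ 1
    bounded y = ≤-trans (≤-reflexive (lab-vertex-rank y)) (≤-trans (toℕ<n _) (≤-reflexive vertexCount))
    onto : ∀ k → 1 ≤ k → k ≤ 2 * n ∸ 1 → ∃ λ y → lab labeling (inj₁ y) ≡ k
    onto (suc k) _ k<2n-1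
      with rank-surjective vertexEnum (≤-trans k<2n-1 (≤-reflexive (sym vertexCount)))
    ... | y , rank≡k = y , trans (lab-vertex-rank y) (cong suc rank≡k)

  weightEnum : Arc n ↔ Fin (2 * n)
  weightEnum = recast arcCount arcsByWeight

  wt-labeling : ∀ e → wt labeling e ≡ + (2 * n + rank weightEnum e)
  wt-labeling e = begin
    wt labeling e                   ≡⟨ wt-from-offsets labeling e (lab-arc c) balance ⟩
    + (2 * n + weightOffset c)      ≡⟨ cong (λ r → + (2 * n + r)) (rank-arcsByWeight c) ⟨
    + (2 * n + rank arcsByWeight e) ≡⟨ cong (λ r → + (2 * n + r)) (rank-recast arcCount arcsByWeight e) ⟨
    + (2 * n + rank weightEnum e)   ∎
    where
    open ≡-Reasoning
    c = classify e
    balance : labelOffset c + lab labeling (inj₁ (head e)) ≡ lab labeling (inj₁ (tail e)) + weightOffset c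
    balance = begin
      labelOffset c + lab labeling (inj₁ (head e))  ≡⟨ cong (_+_ (labelOffset c)) (lab-vertex (head e)) ⟩
      labelOffset c + vertexLabel (head e)          ≡⟨ cong (_+_ (labelOffset c)) (head-label c) ⟩
      labelOffset c + headLabel c                   ≡⟨ offsets-balance c ⟩
      tailLabel c + weightOffset c                  ≡⟨ cong (_+ weightOffset c) (tail-label c) ⟨
      vertexLabel (tail e) + weightOffset c         ≡⟨ cong (_+ weightOffset c) (lab-vertex (tail e)) ⟨
      lab labeling (inj₁ (tail e)) + weightOffset c ∎

  labeling-SAAL : IsSAAL labeling (+ (2 * n)) (+ 1)
  labeling-SAAL =
    ↔⇒⤖ weightEnum , λ e → trans (wt-labeling e) (progression-term (2 * n) (rank weightEnum e))

mainTheorem14 : (n : ℕ) → 3 ≤ n →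
    Σ (TotalLabeling n) (λ L → IsStrong L × IsSAAL L (+ (2 * n)) (+ 1))
mainTheorem14 (suc zero) (s≤s ())
mainTheorem14 (suc (suc q)) _ = labeling , labeling-strong , labeling-SAAL
  where open ButterflyLabeling q
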